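{- If $C^\pi \leq c \cdot \mathrm{OPT}$, then $C^{\pi_\text{out}} \leq (1+\rho) \cdot c \cdot \mathrm{OPT}$, for any $\rho \geq \sqrt{2}$.
   Context: Original problem: a single machine must process jobs $\mathcal{J}$; each job $j$ has a weight $w(j)\ge0$ and is a set of operations, each operation $o$ with processing time $p(o)\ge0$ and family $f(o)\in\{f_1,\dots,f_K\}$. A setup of length $s(f)$ is required before the first operation if it is of family $f$ and whenever the machine switches to an operation of a different family $f$. A job completes when its last operation completes; the objective is the total weighted completion time. $\mathrm{OPT}$ denotes the optimal value of this original problem. One-time setup problem (a relaxation): for each family $f$ a setup operation $o^s_f$ with processing time $s(f)$ and weight $0$ must be processed at some time before every operation of family $f$; the completion time of an operation is the sum of processing times of it and all operations (including setup operations) before it. Jobs are assumed glued (all operations of a job processed consecutively). $\pi$ is a schedule for this relaxed problem with total weighted completion time $C^\pi$ (measured in the relaxed cost model). \textsc{Transform} produces $\pi_\text{out}$: start with the sequence of non-setup operations induced by $\pi$; a batch is a maximal run of consecutive operations of the same family. Iterating over batches $B_1,B_2,\dots$ in order, for batch $B_i$ of family $f$ move as many operations of family $f$ as possible from the closest later batches into $B_i$ while ensuring $p(B_i)<\rho\cdot s(f)$, where $\rho$ is a fixed constant (pull factor) and $p(B_i)$ is the total processing time of $B_i$; batches that become empty are removed. $C^{\pi_\text{out}}$ is the total weighted completion time of $\pi_\text{out}$ in the original cost model (with setups at every family change).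
   Formalization: The processing times, setup times and weights, the pull factor ρ and the constant c are rational rather than real. -}

module Defs where

open import Data.Nat using (ℕ)
open import Data.Fin using (Fin)
open import Data.Fin.Properties using () renaming (_≟_ to _≟ᶠ_)
open import Data.Rational using (ℚ; 0ℚ; _+_; _*_; _⊔_; _≤_; _<_)
open import Data.Rational.Properties using (_<?_)
open import Data.List using (List; []; _∷_; _++_; map; foldr; allFin; length)
open import Data.List.Membership.Propositional using (_∈_)
open import Data.List.Relation.Unary.All using (All)
open import Data.List.Relation.Binary.Permutation.Propositional using (_↭_)
open import Data.Maybe using (Maybe; just; nothing)
open import Data.Product using (_×_; _,_; ∃; Σ)
open import Data.Sum using (_⊎_; inj₁; inj₂)
open import Relation.Nullary using (yes; no)
open import Relation.Binary.PropositionalEquality using (_≡_)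

-- Operation o belongs to job (job o), has family (fam o) and
-- processing time (p o); family f has setup time (s f); job j has
-- weight (w j).  A job is the set of operations o with job o ≡ j.

record Instance : Set where
  field
    K nJ nO : ℕ
    fam : Fin nO → Fin K
    job : Fin nO → Fin nJ
    p   : Fin nO → ℚ
    s   : Fin K → ℚ
    w   : Fin nJ → ℚ

record NonNegInstance (I : Instance) : Set where
  open Instance I
  field
    p≥0 : ∀ o → 0ℚ ≤ p o
    s≥0 : ∀ f → 0ℚ ≤ s f
    w≥0 : ∀ j → 0ℚ ≤ w j

sumℚ : List ℚ → ℚ
sumℚ = foldr _+_ 0ℚ

maxℚ : List ℚ → ℚ
maxℚ = foldr _⊔_ 0ℚ

module _ (I : Instance) where
  open Instance I

  Op : Set
  Op = Fin nO

  Fam : Set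
  Fam = Fin K

  setupBefore : Maybe Fam → Fam → ℚ
  setupBefore nothing  g = s g
  setupBefore (just f) g with f ≟ᶠ g
  ... | yes _ = 0ℚ
  ... | no  _ = s g

  origTimes : Maybe Fam → ℚ → List Op → List (Op × ℚ)
  origTimes prev t [] = []
  origTimes prev t (o ∷ os) =
    let t' = t + setupBefore prev (fam o) + p o
    in (o , t') ∷ origTimes (just (fam o)) t' os

  timesOfJob : Fin nJ → List (Op × ℚ) → List ℚ
  timesOfJob j [] = []
  timesOfJob j ((o , t) ∷ xs) with job o ≟ᶠ j
  ... | yes _ = t ∷ timesOfJob j xs
  ... | no  _ = timesOfJob j xs

  weightedCost : List (Op × ℚ) → ℚ
  weightedCost xs = sumℚ (map (λ j → w j * maxℚ (timesOfJob j xs)) (allFin nJ))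

  IsOrigSchedule : List Op → Set
  IsOrigSchedule σ = σ ↭ allFin nO

  origCost : List Op → ℚ
  origCost σ = weightedCost (origTimes nothing 0ℚ σ)

  IsOPT : ℚ → Set
  IsOPT v = (∃ λ σ → IsOrigSchedule σ × origCost σ ≡ v)
          × (∀ σ → IsOrigSchedule σ → v ≤ origCost σ)

  -- One-time setup problem: items are setup operations (inj₁ f) of
  -- processing time s f, and ordinary operations (inj₂ o).

  Item : Set
  Item = Fam ⊎ Op

  itemTime : Item → ℚ
  itemTime (inj₁ f) = s f
  itemTime (inj₂ o) = p o

  relaxTimes : ℚ → List Item → List (Op × ℚ)
  relaxTimes t [] = []
  relaxTimes t (inj₁ f ∷ xs) = relaxTimes (t + s f) xs
  relaxTimes t (inj₂ o ∷ xs) = (o , t + p o) ∷ relaxTimes (t + p o) xs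

  relaxCost : List Item → ℚ
  relaxCost π = weightedCost (relaxTimes 0ℚ π)

  IsOpOfJob : Fin nJ → Item → Set
  IsOpOfJob j x = ∃ λ o → x ≡ inj₂ o × job o ≡ j

  record IsRelaxSchedule (π : List Item) : Set where
    field
      perm    : π ↭ (map inj₁ (allFin K) ++ map inj₂ (allFin nO))
      setupsFirst : ∀ xs o ys → π ≡ xs ++ inj₂ o ∷ ys → inj₁ (fam o) ∈ xs
      glued   : ∀ xs o ys o' zs → π ≡ xs ++ inj₂ o ∷ ys ++ inj₂ o' ∷ zs →
                job o ≡ job o' → All (IsOpOfJob (job o)) ys

  opsOf : List Item → List Op
  opsOf [] = []
  opsOf (inj₁ _ ∷ xs) = opsOf xs
  opsOf (inj₂ o ∷ xs) = o ∷ opsOf xs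

  spanFam : Fam → List Op → List Op × List Op
  spanFam f [] = [] , []
  spanFam f (o ∷ os) with fam o ≟ᶠ f
  ... | no  _ = [] , o ∷ os
  ... | yes _ with spanFam f os
  ...   | (r , rest) = o ∷ r , rest

  pull : ℚ → Fam → ℚ → List Op → List Op × List Op
  pull ρ f acc [] = [] , []
  pull ρ f acc (o ∷ os) with fam o ≟ᶠ f
  ... | no _ with pull ρ f acc os
  ...   | (a , r) = a , o ∷ r
  pull ρ f acc (o ∷ os) | yes _ with (acc + p o) <? (ρ * s f)
  ...   | no _ = [] , o ∷ os
  ...   | yes _ with pull ρ f (acc + p o) os
  ...     | (a , r) = o ∷ a , r

  -- iterate over batches, with fuel (length of the list suffices)
  transformOps : ℕ → ℚ → List Op → List Op
  transformOps _ ρ [] = []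
  transformOps ℕ.zero ρ (o ∷ os) = o ∷ os
  transformOps (ℕ.suc n) ρ (o ∷ os) with spanFam (fam o) (o ∷ os)
  ... | (B , rest) with pull ρ (fam o) (sumℚ (map p B)) rest
  ...   | (moved , rest') = B ++ moved ++ transformOps n ρ rest'

  transform : ℚ → List Item → List Op
  transform ρ π = transformOps (length (opsOf π)) ρ (opsOf π)

List-Item : Instance → Set
List-Item I = List (Item I)

{-# OPTIONS --safe #-}
module Submission where

-- Transform delays no operation by more than a factor 1 + ρ.  In π an operation x completes no
-- earlier than S + P, where S sums the setup times of the distinct families met up to x and P the
-- processing times up to x; in the output it completes by (1 + ρ) (S + P).  The theorem follows
-- by taking maxima over jobs and weighted sums.
--
-- The output bound is proved round by round (a round is the batch at the head plus the operations
-- pulled into it) in the form t₀ + Σ c g + (1 + ρ) P, with a credit c g for each family met,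
-- initially (1 + ρ) s g, under the invariant that the first remaining operation o of family g has
-- (1 + ρ) s g ≤ c g + ρ p o / 2.  A round of family f pays its setup out of c f, after which c f
-- is renewed to ρ (s f + P_f / 2), P_f being the processing time of the round.  Pulling stopped
-- because the next operation o′ of family f has ρ s f ≤ P_f + p o′, so the invariant holds again
-- for o′ as soon as ρ² ≥ 2.

open import Defs
open import Level using (0ℓ)
open import Function using (_∘_; _∋_)
open import Relation.Nullary using (Dec; yes; no; contradiction)
open import Relation.Nullary.Decidable using (dec⇒maybe)
open import Relation.Binary.PropositionalEquality
open import Data.Product as Prod using (∃; ∃₂; _×_; _,_; proj₁; proj₂)
open import Data.Sum as Sum using (_⊎_; inj₁; inj₂)
import Data.Sum.Properties as Sumₚ
open import Data.Maybe using (Maybe; just; nothing)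
open import Data.Nat as ℕ using (ℕ; zero; suc; s≤s)
import Data.Nat.Properties as ℕ
open import Data.Fin using (Fin; zero; suc; punchIn)
open import Data.Fin.Properties using (punchInᵢ≢i) renaming (_≟_ to _≟ᶠ_)
open import Data.Vec.Functional using (Vector; tail; removeAt; updateAt)
open import Data.Vec.Functional.Properties using (updateAt-updates; updateAt-minimal)
open import Data.Rational using (ℚ; 0ℚ; 1ℚ; _+_; _*_; _≤_; _-_; ½; nonNegative)
import Data.Rational.Properties as ℚ
open import Algebra.Bundles using (CommutativeRing)
open import Algebra.Properties.Semiring.Sum (CommutativeRing.semiring ℚ.+-*-commutativeRing)
  using (sum; sum-remove; sum-cong-≗; sum-replicate-zero; *-distribˡ-sum)
open import Tactic.RingSolver using (solve; solve-∀)
open import Tactic.RingSolver.Core.AlmostCommutativeRing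
  using (AlmostCommutativeRing; fromCommutativeRing)
open import Data.List using (List; []; _∷_; _++_; map; length; _∷ʳ_; allFin)
open import Data.List.Properties using (∷-injectiveˡ; ∷-injectiveʳ; ++-assoc; length-++)
open import Data.List.Relation.Unary.Any as Any using (Any; here; there; any?)
import Data.List.Relation.Unary.Any.Properties as Anyₚ
open import Data.List.Relation.Unary.All as All using (All; []; _∷_)
import Data.List.Relation.Unary.All.Properties as Allₚ
open import Data.List.Membership.Propositional using (_∈_; find)
open import Data.List.Membership.Propositional.Properties using (∈-∃++; ∈-++⁺ˡ)
import Data.List.Membership.DecPropositional as DecMembership
open import Data.List.Relation.Binary.Subset.Propositional using (_⊆_)
open import Data.List.Relation.Binary.Subset.Propositional.Properties as ⊆ₚ using (Any-resp-⊆)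
open import Data.List.Relation.Ternary.Interleaving.Propositional
  using (Interleaving; []; consˡ; consʳ; swap)
open import Data.List.Relation.Ternary.Interleaving.Properties as Interleavingₚ
  using (interleave-length)

ℚ-ring : AlmostCommutativeRing 0ℓ 0ℓ
ℚ-ring = fromCommutativeRing ℚ.+-*-commutativeRing (λ q → dec⇒maybe (0ℚ ℚ.≟ q))

≤-by-slack : ∀ {p q} e → 0ℚ ≤ e → q ≡ p + e → p ≤ q
≤-by-slack {p} e 0≤e refl = begin
  p       ≡⟨ ℚ.+-identityʳ p ⟨
  p + 0ℚ  ≤⟨ ℚ.+-monoʳ-≤ p 0≤e ⟩
  p + e   ∎
  where open ℚ.≤-Reasoning

0≤+ : ∀ {p q} → 0ℚ ≤ p → 0ℚ ≤ q → 0ℚ ≤ p + q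
0≤+ = ℚ.+-mono-≤

0≤* : ∀ {p q} → 0ℚ ≤ p → 0ℚ ≤ q → 0ℚ ≤ p * q
0≤* {p} {q} 0≤p 0≤q =
  ℚ.nonNegative⁻¹ _ {{ℚ.nonNeg*nonNeg⇒nonNeg p {{nonNegative 0≤p}} q {{nonNegative 0≤q}}}}

p≤q⇒0≤q-p : ∀ {p q} → p ≤ q → 0ℚ ≤ q - p
p≤q⇒0≤q-p {p} {q} p≤q = begin
  0ℚ     ≡⟨ ℚ.+-inverseʳ p ⟨
  p - p  ≤⟨ ℚ.+-monoˡ-≤ _ p≤q ⟩
  q - p  ∎
  where open ℚ.≤-Reasoning

*-monoʳ-≤ : ∀ {r p q} → 0ℚ ≤ r → p ≤ q → r * p ≤ r * q
*-monoʳ-≤ {r} 0≤r = ℚ.*-monoˡ-≤-nonNeg r {{nonNegative 0≤r}}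

sum-nonNeg : ∀ {n} (a : Vector ℚ n) → (∀ i → 0ℚ ≤ a i) → 0ℚ ≤ sum a
sum-nonNeg {zero}  a _   = ℚ.≤-refl
sum-nonNeg {suc n} a 0≤a = 0≤+ (0≤a zero) (sum-nonNeg (tail a) (0≤a ∘ suc))

sum-mono-≤ : ∀ {n} {a b : Vector ℚ n} → (∀ i → a i ≤ b i) → sum a ≤ sum b
sum-mono-≤ {zero}  _   = ℚ.≤-refl
sum-mono-≤ {suc n} a≤b = ℚ.+-mono-≤ (a≤b zero) (sum-mono-≤ (a≤b ∘ suc))

≤-sum : ∀ {n} (a : Vector ℚ n) → (∀ i → 0ℚ ≤ a i) → ∀ i → a i ≤ sum a
≤-sum {suc n} a 0≤a i =
  ≤-by-slack _ (sum-nonNeg (removeAt a i) (0≤a ∘ punchIn i)) (sum-remove {i = i} a)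

sum-mono-≤-except : ∀ {n} {a b : Vector ℚ n} i → (∀ j → j ≢ i → a j ≤ b j) →
                    sum a + b i ≤ sum b + a i
sum-mono-≤-except {suc n} {a} {b} i a≤b
  rewrite sum-remove {i = i} a | sum-remove {i = i} b =
    exchange {a i} {b i} (sum-mono-≤ a≤b-off-i)
  where
  a≤b-off-i : ∀ j → removeAt a i j ≤ removeAt b i j
  a≤b-off-i j = a≤b (punchIn i j) (punchInᵢ≢i i j)
  exchange : ∀ {x y A B} → A ≤ B → x + A + y ≤ y + B + x
  exchange {x} {y} {A} {B} A≤B =
    ≤-by-slack (B - A) (p≤q⇒0≤q-p A≤B) (solve (List ℚ ∋ x ∷ y ∷ A ∷ B ∷ []) ℚ-ring)

when : ∀ {a} {A : Set a} → Dec A → ℚ → ℚ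
when (yes _) q = q
when (no _)  _ = 0ℚ

when-nonNeg : ∀ {a} {A : Set a} (d : Dec A) {q} → 0ℚ ≤ q → 0ℚ ≤ when d q
when-nonNeg (yes _) 0≤q = 0≤q
when-nonNeg (no _)  _   = ℚ.≤-refl

when-≤ : ∀ {a} {A : Set a} (d : Dec A) {q} → 0ℚ ≤ q → when d q ≤ q
when-≤ (yes _) _   = ℚ.≤-refl
when-≤ (no _)  0≤q = 0≤q

when-true : ∀ {a} {A : Set a} (d : Dec A) {q} → A → when d q ≡ q
when-true (yes _) _ = refl
when-true (no ¬a) a = contradiction a ¬a

when-mono : ∀ {a b} {A : Set a} {B : Set b} (d : Dec A) (e : Dec B) {q} →
            (A → B) → 0ℚ ≤ q → when d q ≤ when e q
when-mono (yes a) e A⇒B _   = ℚ.≤-reflexive (sym (when-true e (A⇒B a)))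
when-mono (no _)  e _   0≤q = when-nonNeg e 0≤q

when-* : ∀ {a} {A : Set a} (d : Dec A) k q → when d (k * q) ≡ k * when d q
when-* (yes _) k q = refl
when-* (no _)  k q = sym (ℚ.*-zeroʳ k)

maxℚ-nonNeg : ∀ ts → 0ℚ ≤ maxℚ ts
maxℚ-nonNeg []       = ℚ.≤-refl
maxℚ-nonNeg (t ∷ ts) = ℚ.≤-trans (maxℚ-nonNeg ts) (ℚ.p≤q⊔p t (maxℚ ts))

≤-maxℚ : ∀ {t ts} → t ∈ ts → t ≤ maxℚ ts
≤-maxℚ {ts = u ∷ ts} (here refl) = ℚ.p≤p⊔q u (maxℚ ts)
≤-maxℚ {ts = u ∷ ts} (there t∈) = ℚ.≤-trans (≤-maxℚ t∈) (ℚ.p≤q⊔p u (maxℚ ts))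

maxℚ-lub : ∀ {b} ts → 0ℚ ≤ b → (∀ {t} → t ∈ ts → t ≤ b) → maxℚ ts ≤ b
maxℚ-lub []       0≤b _    = 0≤b
maxℚ-lub (t ∷ ts) 0≤b ts≤b = ℚ.⊔-lub (ts≤b (here refl)) (maxℚ-lub ts 0≤b (ts≤b ∘ there))

module _ {A : Set} where

  interleaving-splitʳ : ∀ {l r as r₁ r₂ : List A} {x} →
                        Interleaving l r as → r ≡ r₁ ++ x ∷ r₂ →
                        ∃₂ λ l₁ as₁ → ∃ λ as₂ → as ≡ as₁ ++ x ∷ as₂ × Interleaving l₁ r₁ as₁
  interleaving-splitʳ {r₁ = []}    []         ()
  interleaving-splitʳ {r₁ = _ ∷ _} []         ()
  interleaving-splitʳ              (consˡ sp) eq with interleaving-splitʳ sp eq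
  ... | l₁ , as₁ , as₂ , refl , sp₁ = _ ∷ l₁ , _ ∷ as₁ , as₂ , refl , consˡ sp₁
  interleaving-splitʳ {r₁ = []}    (consʳ _)  refl = [] , [] , _ , refl , []
  interleaving-splitʳ {r₁ = _ ∷ _} (consʳ sp) refl with interleaving-splitʳ sp refl
  ... | l₁ , as₁ , as₂ , refl , sp₁ = l₁ , _ ∷ as₁ , as₂ , refl , consʳ sp₁

  interleaving-splitˡ : ∀ {l r as l₁ l₂ : List A} {x} →
                        Interleaving l r as → l ≡ l₁ ++ x ∷ l₂ →
                        ∃₂ λ r₁ as₁ → ∃ λ as₂ → as ≡ as₁ ++ x ∷ as₂ × Interleaving l₁ r₁ as₁
  interleaving-splitˡ sp eq with interleaving-splitʳ (swap sp) eq
  ... | r₁ , as₁ , as₂ , as≡ , sp₁ = r₁ , as₁ , as₂ , as≡ , swap sp₁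

  interleaving-⊆ʳ : ∀ {l r as : List A} → Interleaving l r as → r ⊆ as
  interleaving-⊆ʳ (consˡ sp) x∈r         = there (interleaving-⊆ʳ sp x∈r)
  interleaving-⊆ʳ (consʳ sp) (here x≡y)  = here x≡y
  interleaving-⊆ʳ (consʳ sp) (there x∈r) = there (interleaving-⊆ʳ sp x∈r)

  interleaving-leftOnly : ∀ (xs : List A) → Interleaving xs [] xs
  interleaving-leftOnly []       = []
  interleaving-leftOnly (x ∷ xs) = consˡ (interleaving-leftOnly xs)

  ++-split : ∀ (ys : List A) {zs as bs x} → ys ++ zs ≡ as ++ x ∷ bs →
             (∃ λ ys₂ → ys ≡ as ++ x ∷ ys₂) ⊎
             (∃₂ λ zs₁ zs₂ → zs ≡ zs₁ ++ x ∷ zs₂ × as ≡ ys ++ zs₁)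
  ++-split []       {as = as} {bs} eq  = inj₂ (as , bs , eq , refl)
  ++-split (y ∷ ys) {as = []}     refl = inj₁ (ys , refl)
  ++-split (y ∷ ys) {as = a ∷ as} eq with ++-split ys (∷-injectiveʳ eq) | ∷-injectiveˡ eq
  ... | inj₁ (ys₂ , refl)             | refl = inj₁ (ys₂ , refl)
  ... | inj₂ (zs₁ , zs₂ , zs≡ , refl) | refl = inj₂ (zs₁ , zs₂ , zs≡ , refl)

  head-∈-prefix : ∀ {y : A} {ys xs x zs} → y ∷ ys ≡ xs ++ x ∷ zs → y ∈ xs ∷ʳ x
  head-∈-prefix {xs = []}    refl = here refl
  head-∈-prefix {xs = _ ∷ _} refl = here refl

-- The credit inequalities

module CreditArithmetic (ρ : ℚ) (0≤ρ : 0ℚ ≤ ρ) (2≤ρ² : 1ℚ + 1ℚ ≤ ρ * ρ) where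

  0≤1+ρ : 0ℚ ≤ 1ℚ + ρ
  0≤1+ρ = 0≤+ (ℚ.nonNegative⁻¹ 1ℚ) 0≤ρ

  0≤ρ*½ : ∀ {q} → 0ℚ ≤ q → 0ℚ ≤ ρ * q * ½
  0≤ρ*½ 0≤q = 0≤* (0≤* 0≤ρ 0≤q) (ℚ.nonNegative⁻¹ ½)

  setup-covered : ∀ {s c h L} → (1ℚ + ρ) * s ≤ c + ρ * h * ½ →
                  0ℚ ≤ s → 0ℚ ≤ h → h ≤ L → s + L ≤ c + (1ℚ + ρ) * L
  setup-covered {s} {c} {h} {L} credit 0≤s 0≤h h≤L =
    ≤-by-slack (c + ρ * h * ½ - (1ℚ + ρ) * s + ρ * s + ρ * (L - h) + ρ * h * ½)
      (0≤+ (0≤+ (0≤+ (p≤q⇒0≤q-p credit) (0≤* 0≤ρ 0≤s)) (0≤* 0≤ρ (p≤q⇒0≤q-p h≤L)))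
           (0≤ρ*½ 0≤h))
      (solve (List ℚ ∋ s ∷ c ∷ h ∷ L ∷ ρ ∷ []) ℚ-ring)

  batch-covered : ∀ {s c h LB Lm} → (1ℚ + ρ) * s ≤ c + ρ * h * ½ →
                  0ℚ ≤ s → 0ℚ ≤ h → h ≤ LB → Lm ≡ 0ℚ ⊎ LB + Lm ≤ ρ * s →
                  s + (LB + Lm) + 0ℚ ≤ c + (1ℚ + ρ) * LB
  batch-covered {s} {c} {h} {LB} credit 0≤s 0≤h h≤LB (inj₁ refl) = begin
    s + (LB + 0ℚ) + 0ℚ  ≡⟨ solve (List ℚ ∋ s ∷ LB ∷ []) ℚ-ring ⟩
    s + LB              ≤⟨ setup-covered {c = c} credit 0≤s 0≤h h≤LB ⟩
    c + (1ℚ + ρ) * LB   ∎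
    where open ℚ.≤-Reasoning
  batch-covered {s} {c} {h} {LB} {Lm} credit 0≤s 0≤h h≤LB (inj₂ small) =
    ≤-by-slack (ρ * s - (LB + Lm) + (c + ρ * h * ½ - (1ℚ + ρ) * s)
                + ρ * (LB - h) * ½ + ρ * LB * ½ + LB)
      (0≤+ (0≤+ (0≤+ (0≤+ (p≤q⇒0≤q-p small) (p≤q⇒0≤q-p credit))
                     (0≤ρ*½ (p≤q⇒0≤q-p h≤LB)))
                (0≤ρ*½ 0≤LB))
           0≤LB)
      (solve (List ℚ ∋ s ∷ c ∷ h ∷ LB ∷ Lm ∷ ρ ∷ []) ℚ-ring)
    where 0≤LB = ℚ.≤-trans 0≤h h≤LB

  batch-covered-renewed : ∀ {s c h LB Lm} → (1ℚ + ρ) * s ≤ c + ρ * h * ½ → h ≤ LB → 0ℚ ≤ Lm →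
                          s + (LB + Lm) + (ρ * (LB + Lm) * ½ + ρ * s) ≤ c + (1ℚ + ρ) * (LB + Lm)
  batch-covered-renewed {s} {c} {h} {LB} {Lm} credit h≤LB 0≤Lm =
    ≤-by-slack (c + ρ * h * ½ - (1ℚ + ρ) * s + ρ * (LB - h) * ½ + ρ * Lm * ½)
      (0≤+ (0≤+ (p≤q⇒0≤q-p credit) (0≤ρ*½ (p≤q⇒0≤q-p h≤LB))) (0≤ρ*½ 0≤Lm))
      (solve (List ℚ ∋ s ∷ c ∷ h ∷ LB ∷ Lm ∷ ρ ∷ []) ℚ-ring)

  -- The only place where ρ² ≥ 2 is needed.
  renewal : ∀ {s Q q} → ρ * s ≤ Q + q → 0ℚ ≤ s →
            (1ℚ + ρ) * s ≤ ρ * Q * ½ + ρ * s + ρ * q * ½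
  renewal {s} {Q} {q} overflow 0≤s =
    ≤-by-slack (ρ * (Q + q - ρ * s) * ½ + s * (ρ * ρ - (1ℚ + 1ℚ)) * ½)
      (0≤+ (0≤ρ*½ (p≤q⇒0≤q-p overflow))
           (0≤* (0≤* 0≤s (p≤q⇒0≤q-p 2≤ρ²)) (ℚ.nonNegative⁻¹ ½)))
      (solve (List ℚ ∋ s ∷ Q ∷ q ∷ ρ ∷ []) ℚ-ring)

  batch-combine : ∀ {t t₀ sb LA s L c K} → t ≡ t₀ + sb + LA → sb ≤ s → LA ≤ L →
                  s + L ≤ c + (1ℚ + ρ) * L → c ≤ K → t ≤ t₀ + K + (1ℚ + ρ) * L
  batch-combine {t} {t₀} {sb} {LA} {s} {L} {c} {K} refl sb≤s LA≤L covered c≤K =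
    ≤-by-slack (s - sb + (L - LA) + (c + (1ℚ + ρ) * L - (s + L)) + (K - c))
      (0≤+ (0≤+ (0≤+ (p≤q⇒0≤q-p sb≤s) (p≤q⇒0≤q-p LA≤L)) (p≤q⇒0≤q-p covered))
           (p≤q⇒0≤q-p c≤K))
      (solve (List ℚ ∋ t₀ ∷ sb ∷ LA ∷ s ∷ L ∷ c ∷ K ∷ ρ ∷ []) ℚ-ring)

  rest-combine : ∀ {t t₀ t₁ s Lb c e K K′ L₁ L′ L} →
                 t ≤ t₁ + K′ + (1ℚ + ρ) * L′ → t₁ ≤ t₀ + s + Lb → K′ + c ≤ K + e →
                 s + Lb + e ≤ c + (1ℚ + ρ) * L₁ → L₁ + L′ ≤ L → t ≤ t₀ + K + (1ℚ + ρ) * L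
  rest-combine {t} {t₀} {t₁} {s} {Lb} {c} {e} {K} {K′} {L₁} {L′} {L}
               t≤ t₁≤ exchange covered L₁+L′≤L =
    ≤-by-slack (t₁ + K′ + (1ℚ + ρ) * L′ - t + (t₀ + s + Lb - t₁) + (K + e - (K′ + c))
                + (c + (1ℚ + ρ) * L₁ - (s + Lb + e)) + (1ℚ + ρ) * (L - (L₁ + L′)))
      (0≤+ (0≤+ (0≤+ (0≤+ (p≤q⇒0≤q-p t≤) (p≤q⇒0≤q-p t₁≤)) (p≤q⇒0≤q-p exchange))
                (p≤q⇒0≤q-p covered))
           (0≤* 0≤1+ρ (p≤q⇒0≤q-p L₁+L′≤L)))
      (solve (List ℚ ∋ t ∷ t₀ ∷ t₁ ∷ s ∷ Lb ∷ c ∷ e ∷ K ∷ K′ ∷ L₁ ∷ L′ ∷ L ∷ ρ ∷ []) ℚ-ring)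

  relaxed-combine : ∀ {t F L q S E} → t ≤ 0ℚ + (1ℚ + ρ) * F + (1ℚ + ρ) * (L + q) →
                    F ≤ S → 0ℚ + S + L ≤ E → t ≤ (1ℚ + ρ) * (E + q)
  relaxed-combine {t} {F} {L} {q} {S} {E} t≤ F≤S S+L≤E =
    ≤-by-slack (0ℚ + (1ℚ + ρ) * F + (1ℚ + ρ) * (L + q) - t
                + (1ℚ + ρ) * (S - F) + (1ℚ + ρ) * (E - (0ℚ + S + L)))
      (0≤+ (0≤+ (p≤q⇒0≤q-p t≤) (0≤* 0≤1+ρ (p≤q⇒0≤q-p F≤S)))
           (0≤* 0≤1+ρ (p≤q⇒0≤q-p S+L≤E)))
      (solve (List ℚ ∋ t ∷ F ∷ L ∷ q ∷ S ∷ E ∷ ρ ∷ []) ℚ-ring)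

module Schedule (I : Instance) (nonNeg : NonNegInstance I) where
  open Instance I
  open NonNegInstance nonNeg
  open DecMembership {A = Item I} (Sumₚ.≡-dec _≟ᶠ_ _≟ᶠ_) using (_∈?_)

  Ops : Set
  Ops = List (Op I)

  load : Ops → ℚ
  load zs = sumℚ (map p zs)

  load-nonNeg : ∀ zs → 0ℚ ≤ load zs
  load-nonNeg []       = ℚ.≤-refl
  load-nonNeg (z ∷ zs) = 0≤+ (p≥0 z) (load-nonNeg zs)

  load-++ : ∀ xs ys → load (xs ++ ys) ≡ load xs + load ys
  load-++ []       ys = sym (ℚ.+-identityˡ (load ys))
  load-++ (x ∷ xs) ys =
    trans (cong (p x +_) (load-++ xs ys)) (sym (ℚ.+-assoc (p x) (load xs) (load ys)))

  load-∷ʳ : ∀ xs x → load (xs ∷ʳ x) ≡ load xs + p x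
  load-∷ʳ xs x = trans (load-++ xs (x ∷ [])) (cong (load xs +_) (ℚ.+-identityʳ (p x)))

  load-interleaving : ∀ {l r as} → Interleaving l r as → load as ≡ load l + load r
  load-interleaving []                             = refl
  load-interleaving {as = x ∷ _}        (consˡ sp) =
    trans (cong (p x +_) (load-interleaving sp)) (sym (ℚ.+-assoc (p x) _ _))
  load-interleaving {l} {_ ∷ r} {x ∷ _} (consʳ sp) =
    trans (cong (p x +_) (load-interleaving sp)) (swap-middle (p x) (load l) (load r))
    where
    swap-middle : ∀ a b c → a + (b + c) ≡ b + (a + c)
    swap-middle = solve-∀ ℚ-ring

  ∈⇒≤load : ∀ {o zs} → o ∈ zs → p o ≤ load zs
  ∈⇒≤load {zs = z ∷ zs} (here refl)  = ≤-by-slack (load zs) (load-nonNeg zs) refl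
  ∈⇒≤load {zs = z ∷ zs} (there o∈zs) =
    ℚ.≤-trans (∈⇒≤load o∈zs) (≤-by-slack (p z) (p≥0 z) (ℚ.+-comm (p z) (load zs)))

  HasFamily : Fam I → Ops → Set
  HasFamily g = Any (λ o → fam o ≡ g)

  hasFamily? : ∀ g zs → Dec (HasFamily g zs)
  hasFamily? g = any? (λ o → fam o ≟ᶠ g)

  ∈⇒HasFamily : ∀ {o zs} → o ∈ zs → HasFamily (fam o) zs
  ∈⇒HasFamily = Any.map (λ o≡y → cong fam (sym o≡y))

  familySum : (Fam I → ℚ) → Ops → ℚ
  familySum c zs = sum (λ g → when (hasFamily? g zs) (c g))

  ≤-familySum : ∀ {c g zs} → (∀ g → 0ℚ ≤ c g) → HasFamily g zs → c g ≤ familySum c zs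
  ≤-familySum {c} {g} {zs} 0≤c g∈zs = begin
    c g                           ≡⟨ when-true (hasFamily? g zs) g∈zs ⟨
    when (hasFamily? g zs) (c g)  ≤⟨ ≤-sum _ (λ h → when-nonNeg (hasFamily? h zs) (0≤c h)) g ⟩
    familySum c zs                ∎
    where open ℚ.≤-Reasoning

  familySum-exchange : ∀ {c c′ f X′ X} → (∀ g → 0ℚ ≤ c g) → (∀ g → g ≢ f → c′ g ≡ c g) →
                       X′ ⊆ X → HasFamily f X →
                       familySum c′ X′ + c f ≤ familySum c X + when (hasFamily? f X′) (c′ f)
  familySum-exchange {c} {c′} {f} {X′} {X} 0≤c c′≡c X′⊆X f∈X = begin
    familySum c′ X′ + c f                          ≡⟨ cong (familySum c′ X′ +_) c-f ⟨
    familySum c′ X′ + when (hasFamily? f X) (c f)  ≤⟨ sum-mono-≤-except f fewer-families ⟩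
    familySum c X + when (hasFamily? f X′) (c′ f)  ∎
    where
    open ℚ.≤-Reasoning
    c-f : when (hasFamily? f X) (c f) ≡ c f
    c-f = when-true (hasFamily? f X) f∈X
    fewer-families : ∀ g → g ≢ f → when (hasFamily? g X′) (c′ g) ≤ when (hasFamily? g X) (c g)
    fewer-families g g≢f rewrite c′≡c g g≢f =
      when-mono (hasFamily? g X′) (hasFamily? g X) (Any-resp-⊆ X′⊆X) (0≤c g)

  familySum-* : ∀ k c zs → familySum (λ g → k * c g) zs ≡ k * familySum c zs
  familySum-* k c zs = trans (sum-cong-≗ (λ g → when-* (hasFamily? g zs) k (c g)))
                             (sym (*-distribˡ-sum k (λ g → when (hasFamily? g zs) (c g))))

  others-absent : ∀ {f g zs} → g ≢ f → All (λ y → fam y ≡ f) zs → All (λ y → fam y ≢ g) zs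
  others-absent g≢f = All.map (λ fy≡f fy≡g → g≢f (trans (sym fy≡g) fy≡f))

  data AtFirst (g : Fam I) (Q : Op I → Set) : Ops → Set where
    []    : AtFirst g Q []
    here  : ∀ {o os} → fam o ≡ g → Q o → AtFirst g Q (o ∷ os)
    there : ∀ {o os} → fam o ≢ g → AtFirst g Q os → AtFirst g Q (o ∷ os)

  module _ {g : Fam I} {Q : Op I → Set} where

    AtFirst-map : ∀ {Q′ : Op I → Set} {R} → (∀ {o} → Q o → Q′ o) →
                  AtFirst g Q R → AtFirst g Q′ R
    AtFirst-map Q⇒Q′ []              = []
    AtFirst-map Q⇒Q′ (here fo≡g q)   = here fo≡g (Q⇒Q′ q)
    AtFirst-map Q⇒Q′ (there fo≢g at) = there fo≢g (AtFirst-map Q⇒Q′ at)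

    AtFirst-universal : (∀ o → Q o) → ∀ R → AtFirst g Q R
    AtFirst-universal q []       = []
    AtFirst-universal q (o ∷ os) with fam o ≟ᶠ g
    ... | yes fo≡g = here fo≡g (q o)
    ... | no  fo≢g = there fo≢g (AtFirst-universal q os)

    AtFirst-head : ∀ {o os} → fam o ≡ g → AtFirst g Q (o ∷ os) → Q o
    AtFirst-head _    (here _ q)     = q
    AtFirst-head fo≡g (there fo≢g _) = contradiction fo≡g fo≢g

    AtFirst-++⁻ : ∀ {B R} → All (λ o → fam o ≢ g) B → AtFirst g Q (B ++ R) → AtFirst g Q R
    AtFirst-++⁻ []           at            = at
    AtFirst-++⁻ (fo≢g ∷ _)   (here fo≡g _) = contradiction fo≡g fo≢g
    AtFirst-++⁻ (_ ∷ B-fams) (there _ at)  = AtFirst-++⁻ B-fams at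

    AtFirst-interleaving : ∀ {m u ws v} → All (λ o → fam o ≢ g) m → Interleaving m u ws →
                           AtFirst g Q (ws ++ v) → AtFirst g Q (u ++ v)
    AtFirst-interleaving _            []         at              = at
    AtFirst-interleaving (fo≢g ∷ _)   (consˡ _)  (here fo≡g _)   = contradiction fo≡g fo≢g
    AtFirst-interleaving (_ ∷ m-fams) (consˡ sp) (there _ at)    = AtFirst-interleaving m-fams sp at
    AtFirst-interleaving _            (consʳ _)  (here fo≡g q)   = here fo≡g q
    AtFirst-interleaving m-fams       (consʳ sp) (there fo≢g at) =
      there fo≢g (AtFirst-interleaving m-fams sp at)

  lastFamily : Maybe (Fam I) → Ops → Maybe (Fam I)
  lastFamily prev []       = prev
  lastFamily prev (o ∷ os) = lastFamily (just (fam o)) os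

  endTime : Maybe (Fam I) → ℚ → Ops → ℚ
  endTime prev t []       = t
  endTime prev t (o ∷ os) = endTime (just (fam o)) (t + setupBefore I prev (fam o) + p o) os

  ∈-origTimes-++⁻ : ∀ {prev t x t′} zs {ws} → (x , t′) ∈ origTimes I prev t (zs ++ ws) →
                    (x , t′) ∈ origTimes I prev t zs ⊎
                    (x , t′) ∈ origTimes I (lastFamily prev zs) (endTime prev t zs) ws
  ∈-origTimes-++⁻ []       x∈         = inj₂ x∈
  ∈-origTimes-++⁻ (z ∷ zs) (here x≡z) = inj₁ (here x≡z)
  ∈-origTimes-++⁻ (z ∷ zs) (there x∈) with ∈-origTimes-++⁻ zs x∈
  ... | inj₁ x∈zs = inj₁ (there x∈zs)
  ... | inj₂ x∈ws = inj₂ x∈ws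

  setupBefore-≤ : ∀ prev g → setupBefore I prev g ≤ s g
  setupBefore-≤ nothing  g = ℚ.≤-refl
  setupBefore-≤ (just f) g with f ≟ᶠ g
  ... | yes _ = s≥0 g
  ... | no  _ = ℚ.≤-refl

  setupBefore-nonNeg : ∀ prev g → 0ℚ ≤ setupBefore I prev g
  setupBefore-nonNeg nothing  g = s≥0 g
  setupBefore-nonNeg (just f) g with f ≟ᶠ g
  ... | yes _ = ℚ.≤-refl
  ... | no  _ = s≥0 g

  setupBefore-same : ∀ f → setupBefore I (just f) f ≡ 0ℚ
  setupBefore-same f with f ≟ᶠ f
  ... | yes _   = refl
  ... | no  f≢f = contradiction refl f≢f

  run-step : ∀ prev f t z L → t + setupBefore I prev f + p z + setupBefore I (just f) f + L ≡
                              t + setupBefore I prev f + (p z + L)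
  run-step prev f t z L = begin-equality
    t + sb + p z + setupBefore I (just f) f + L  ≡⟨ cong (λ q → t + sb + p z + q + L)
                                                         (setupBefore-same f) ⟩
    t + sb + p z + 0ℚ + L                        ≡⟨ cong (_+ L) (ℚ.+-identityʳ (t + sb + p z)) ⟩
    t + sb + p z + L                             ≡⟨ ℚ.+-assoc (t + sb) (p z) L ⟩
    t + sb + (p z + L)                           ∎
    where
    open ℚ.≤-Reasoning
    sb = setupBefore I prev f

  endTime-run : ∀ {f} prev t zs → All (λ o → fam o ≡ f) zs →
                endTime prev t zs ≤ t + setupBefore I prev f + load zs
  endTime-run {f} prev t []       []            =
    ≤-by-slack _ (0≤+ (setupBefore-nonNeg prev f) ℚ.≤-refl) (ℚ.+-assoc t _ 0ℚ)
  endTime-run     prev t (z ∷ zs) (refl ∷ fams) = begin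
    endTime prev t (z ∷ zs)                         ≤⟨ endTime-run _ _ zs fams ⟩
    t + sb + p z + setupBefore I (just f) f + load zs  ≡⟨ run-step prev f t z (load zs) ⟩
    t + sb + load (z ∷ zs)                          ∎
    where
    open ℚ.≤-Reasoning
    f  = fam z
    sb = setupBefore I prev f

  origTimes-run : ∀ {f x t′} prev t zs → All (λ o → fam o ≡ f) zs →
                  (x , t′) ∈ origTimes I prev t zs →
                  ∃₂ λ as bs → zs ≡ as ++ x ∷ bs × t′ ≡ t + setupBefore I prev f + load (as ∷ʳ x)
  origTimes-run prev t (z ∷ zs) (refl ∷ fams) (here refl) =
    [] , zs , refl , cong (t + setupBefore I prev (fam z) +_) (sym (ℚ.+-identityʳ (p z)))
  origTimes-run {x = x} prev t (z ∷ zs) (refl ∷ fams) (there x∈)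
    with origTimes-run _ _ zs fams x∈
  ... | as , bs , refl , t′≡ =
    z ∷ as , bs , refl , trans t′≡ (run-step prev (fam z) t z (load (as ∷ʳ x)))

  -- One round of Transform

  spanFam-spec : ∀ f l → l ≡ proj₁ (spanFam I f l) ++ proj₂ (spanFam I f l)
                       × All (λ o → fam o ≡ f) (proj₁ (spanFam I f l))
  spanFam-spec f []       = refl , []
  spanFam-spec f (o ∷ os) with fam o ≟ᶠ f
  ... | no  _    = refl , []
  ... | yes fo≡f with spanFam I f os | spanFam-spec f os
  ...   | _ | os≡ , fams = cong (o ∷_) os≡ , fo≡f ∷ fams

  spanFam-head : ∀ o os → ∃ λ B₁ → proj₁ (spanFam I (fam o) (o ∷ os)) ≡ o ∷ B₁
  spanFam-head o os with fam o ≟ᶠ fam o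
  ... | no  fo≢fo = contradiction refl fo≢fo
  ... | yes _ with spanFam I (fam o) os
  ...   | B₁ , _ = B₁ , refl

  module Rounds (ρ : ℚ) where

    record Pulled (f : Fam I) (acc : ℚ) (l m r : Ops) : Set where
      field
        u ws v   : Ops
        l≡ws++v  : l ≡ ws ++ v
        r≡u++v   : r ≡ u ++ v
        merge    : Interleaving m u ws
        m-family : All (λ o → fam o ≡ f) m
        u-family : All (λ o → fam o ≢ f) u
        fits     : m ≡ [] ⊎ acc + load m ≤ ρ * s f
        overflow : AtFirst f (λ o → ρ * s f ≤ acc + load m + p o) r

    pull-spec : ∀ f acc l → Pulled f acc l (proj₁ (pull I ρ f acc l)) (proj₂ (pull I ρ f acc l))
    pull-spec f acc [] = record
      { u = [] ; ws = [] ; v = [] ; l≡ws++v = refl ; r≡u++v = refl ; merge = []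
      ; m-family = [] ; u-family = [] ; fits = inj₁ refl ; overflow = [] }
    pull-spec f acc (o ∷ os) with fam o ≟ᶠ f
    ... | no fo≢f with pull I ρ f acc os | pull-spec f acc os
    ...   | _ | P = record
      { u = o ∷ u ; ws = o ∷ ws ; v = v
      ; l≡ws++v = cong (o ∷_) l≡ws++v ; r≡u++v = cong (o ∷_) r≡u++v ; merge = consʳ merge
      ; m-family = m-family ; u-family = fo≢f ∷ u-family
      ; fits = fits ; overflow = there fo≢f overflow }
      where open Pulled P
    pull-spec f acc (o ∷ os) | yes fo≡f with (acc + p o) ℚ.<? (ρ * s f)
    ... | no ¬fits = record
      { u = [] ; ws = [] ; v = o ∷ os ; l≡ws++v = refl ; r≡u++v = refl ; merge = []
      ; m-family = [] ; u-family = [] ; fits = inj₁ refl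
      ; overflow = here fo≡f (subst (λ a → ρ * s f ≤ a + p o) (sym (ℚ.+-identityʳ acc))
                                    (ℚ.≮⇒≥ ¬fits)) }
    ... | yes fits′ with pull I ρ f (acc + p o) os | pull-spec f (acc + p o) os
    ...   | (m , _) | P = record
      { u = u ; ws = o ∷ ws ; v = v
      ; l≡ws++v = cong (o ∷_) l≡ws++v ; r≡u++v = r≡u++v ; merge = consˡ merge
      ; m-family = fo≡f ∷ m-family ; u-family = u-family
      ; fits = inj₂ (fits-∷ fits)
      ; overflow = AtFirst-map (subst (λ a → ρ * s f ≤ a + _) (ℚ.+-assoc acc (p o) (load m)))
                               overflow }
      where
      open Pulled P
      fits-∷ : m ≡ [] ⊎ acc + p o + load m ≤ ρ * s f → acc + load (o ∷ m) ≤ ρ * s f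
      fits-∷ (inj₁ refl) =
        subst (_≤ ρ * s f) (cong (acc +_) (sym (ℚ.+-identityʳ (p o)))) (ℚ.<⇒≤ fits′)
      fits-∷ (inj₂ ≤ρs)  = subst (_≤ ρ * s f) (ℚ.+-assoc acc (p o) (load m)) ≤ρs

    -- The batch o ∷ B₁ at the head of o ∷ os is followed by ws ++ v; the operations m pulled
    -- into the batch are interleaved in ws with the skipped operations u of other families.
    record Round (n : ℕ) (o : Op I) (os : Ops) : Set where
      field
        B₁ m u ws v : Ops
        input    : o ∷ os ≡ o ∷ B₁ ++ ws ++ v
        output   : transformOps I (suc n) ρ (o ∷ os) ≡ o ∷ B₁ ++ m ++ transformOps I n ρ (u ++ v)
        B-family : All (λ y → fam y ≡ fam o) B₁
        m-family : All (λ y → fam y ≡ fam o) m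
        u-family : All (λ y → fam y ≢ fam o) u
        merge    : Interleaving m u ws
        fits     : m ≡ [] ⊎ load (o ∷ B₁) + load m ≤ ρ * s (fam o)
        overflow : AtFirst (fam o) (λ y → ρ * s (fam o) ≤ load (o ∷ B₁) + load m + p y) (u ++ v)

    transformOps-step : ∀ n o os → ∃₂ λ B rest → ∃₂ λ m r →
      spanFam I (fam o) (o ∷ os) ≡ (B , rest) × pull I ρ (fam o) (load B) rest ≡ (m , r) ×
      transformOps I (suc n) ρ (o ∷ os) ≡ B ++ m ++ transformOps I n ρ r
    transformOps-step n o os with spanFam I (fam o) (o ∷ os)
    ... | (B , rest) with pull I ρ (fam o) (load B) rest in pull≡
    ... | (m , r) = B , rest , m , r , refl , pull≡ , refl

    round : ∀ n o os → Round n o os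
    round n o os with transformOps-step n o os
    ... | B , rest , m , r , span≡ , pull≡ , step
        with subst (λ q → ∃ λ B₁ → proj₁ q ≡ o ∷ B₁) span≡ (spanFam-head o os)
           | subst (λ q → o ∷ os ≡ proj₁ q ++ proj₂ q × All (λ y → fam y ≡ fam o) (proj₁ q))
                   span≡ (spanFam-spec (fam o) (o ∷ os))
           | subst (λ q → Pulled (fam o) (load B) rest (proj₁ q) (proj₂ q)) pull≡
                   (pull-spec (fam o) (load B) rest)
    ... | B₁ , refl | in≡ , _ ∷ B-family | P = record
      { B₁ = B₁ ; m = m ; u = u ; ws = ws ; v = v
      ; input = trans in≡ (cong (o ∷_) (cong (B₁ ++_) l≡ws++v))
      ; output = trans step (cong (λ r → o ∷ B₁ ++ m ++ transformOps I n ρ r) r≡u++v)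
      ; B-family = B-family ; m-family = m-family ; u-family = u-family ; merge = merge
      ; fits = fits ; overflow = subst (AtFirst _ _) r≡u++v overflow }
      where open Pulled P

  -- The credit invariant

  module Credits (ρ : ℚ) (0≤ρ : 0ℚ ≤ ρ) (2≤ρ² : 1ℚ + 1ℚ ≤ ρ * ρ) where
    open Rounds ρ
    open CreditArithmetic ρ 0≤ρ 2≤ρ²

    record Credit (c : Fam I → ℚ) (R : Ops) : Set where
      field
        c≥0    : ∀ g → 0ℚ ≤ c g
        covers : ∀ g → AtFirst g (λ o → (1ℚ + ρ) * s g ≤ c g + ρ * p o * ½) R

    WithinBound : ℚ → (Fam I → ℚ) → Ops → Op I → ℚ → Set
    WithinBound t₀ c R x t = ∃₂ λ xs ys → R ≡ xs ++ x ∷ ys ×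
                             t ≤ t₀ + familySum c (xs ∷ʳ x) + (1ℚ + ρ) * load (xs ∷ʳ x)

    module AfterRound {n o os} (rd : Round n o os) {c : Fam I → ℚ} (credit : Credit c (o ∷ os))
      where
      open Round rd
      open Credit credit

      f : Fam I
      f = fam o

      B : Ops
      B = o ∷ B₁

      shrinks : length (u ++ v) ℕ.≤ length os
      shrinks = begin
        length (u ++ v)                     ≡⟨ length-++ u ⟩
        length u ℕ.+ length v               ≤⟨ ℕ.+-monoˡ-≤ (length v) (ℕ.m≤n+m _ (length m)) ⟩
        length m ℕ.+ length u ℕ.+ length v  ≡⟨ cong (ℕ._+ length v) (interleave-length merge) ⟨
        length ws ℕ.+ length v              ≡⟨ length-++ ws ⟨
        length (ws ++ v)                    ≤⟨ ℕ.m≤n+m (length (ws ++ v)) (length B₁) ⟩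
        length B₁ ℕ.+ length (ws ++ v)      ≡⟨ length-++ B₁ ⟨
        length (B₁ ++ ws ++ v)              ≡⟨ cong length (∷-injectiveʳ input) ⟨
        length os                           ∎
        where open ℕ.≤-Reasoning

      head-credit : (1ℚ + ρ) * s f ≤ c f + ρ * p o * ½
      head-credit = AtFirst-head refl (covers f)

      po≤LB : p o ≤ load B
      po≤LB = ∈⇒≤load {zs = B} (here refl)

      renewed : Fam I → ℚ
      renewed = updateAt c f (λ _ → ρ * (load B + load m) * ½ + ρ * s f)

      renewed-credit : Credit renewed (u ++ v)
      renewed-credit = record { c≥0 = renewed≥0 ; covers = renewed-covers }
        where
        renewed≥0 : ∀ g → 0ℚ ≤ renewed g
        renewed≥0 g with g ≟ᶠ f
        ... | yes refl = subst (0ℚ ≤_) (sym (updateAt-updates f c))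
                           (0≤+ (0≤ρ*½ (0≤+ (load-nonNeg B) (load-nonNeg m))) (0≤* 0≤ρ (s≥0 f)))
        ... | no  g≢f  = subst (0ℚ ≤_) (sym (updateAt-minimal g f c g≢f)) (c≥0 g)

        renewed-covers : ∀ g → AtFirst g (λ y → (1ℚ + ρ) * s g ≤ renewed g + ρ * p y * ½) (u ++ v)
        renewed-covers g with g ≟ᶠ f
        ... | yes refl = AtFirst-map
          (λ ρs≤ → subst (λ r → (1ℚ + ρ) * s f ≤ r + _) (sym (updateAt-updates f c))
                         (renewal ρs≤ (s≥0 f)))
          overflow
        ... | no  g≢f  = AtFirst-map
          (subst (λ r → (1ℚ + ρ) * s g ≤ r + _) (sym (updateAt-minimal g f c g≢f)))
          (AtFirst-interleaving (others-absent g≢f m-family) merge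
            (AtFirst-++⁻ (others-absent g≢f (refl ∷ B-family))
              (subst (AtFirst g _) input (covers g))))

      batch-position : ∀ {as x bs} → B ++ m ≡ as ++ x ∷ bs →
                       ∃₂ λ xs ys → o ∷ os ≡ xs ++ x ∷ ys × load (as ∷ʳ x) ≤ load (xs ∷ʳ x)
      batch-position {as} {x} Bm≡
        with interleaving-splitˡ (Interleavingₚ.++⁺ (interleaving-leftOnly B) merge) Bm≡
      ... | u₁ , xs , ys , Bws≡ , sp = xs , ys ++ v , R≡ , load-≤
        where
        R≡ : o ∷ os ≡ xs ++ x ∷ ys ++ v
        R≡ = begin
          o ∷ os               ≡⟨ input ⟩
          B ++ ws ++ v         ≡⟨ ++-assoc B ws v ⟨
          (B ++ ws) ++ v       ≡⟨ cong (_++ v) Bws≡ ⟩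
          (xs ++ x ∷ ys) ++ v  ≡⟨ ++-assoc xs (x ∷ ys) v ⟩
          xs ++ x ∷ ys ++ v    ∎
          where open ≡-Reasoning
        load-≤ : load (as ∷ʳ x) ≤ load (xs ∷ʳ x)
        load-≤ rewrite load-∷ʳ as x | load-∷ʳ xs x | load-interleaving sp =
          ℚ.+-monoˡ-≤ (p x) (≤-by-slack {load as} (load u₁) (load-nonNeg u₁) refl)

      batch-within : ∀ {prev t₀ x t} → (x , t) ∈ origTimes I prev t₀ (B ++ m) →
                     WithinBound t₀ c (o ∷ os) x t
      batch-within {prev} {t₀} mem
        with origTimes-run prev t₀ (B ++ m) (refl ∷ Allₚ.++⁺ B-family m-family) mem
      ... | as , bs , Bm≡ , t≡ with batch-position Bm≡
      ... | xs , ys , R≡ , LA≤LX = xs , ys , R≡ ,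
            batch-combine {t₀ = t₀} {c = c f} t≡ (setupBefore-≤ prev f) LA≤LX
              (setup-covered {c = c f} head-credit (s≥0 f) (p≥0 o) (∈⇒≤load o∈X))
              (≤-familySum c≥0 (∈⇒HasFamily o∈X))
        where o∈X = head-∈-prefix R≡

      record PrefixEmbedding (X′ X : Ops) : Set where
        field
          families : X′ ⊆ X
          load-B   : load B + load X′ ≤ load X
          load-Bm  : HasFamily f X′ → load B + load m + load X′ ≤ load X

      rest-position : ∀ {xs′ x ys′} → u ++ v ≡ xs′ ++ x ∷ ys′ →
                      ∃₂ λ xs ys → o ∷ os ≡ xs ++ x ∷ ys × PrefixEmbedding (xs′ ∷ʳ x) (xs ∷ʳ x)
      rest-position {xs′} {x} uv≡ with ++-split u uv≡
      ... | inj₁ (u₂ , u≡) with interleaving-splitʳ merge u≡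
      ...   | m₁ , ws₁ , ws₂ , ws≡ , sp = B ++ ws₁ , ws₂ ++ v , R≡ , record
        { families = ⊆ₚ.++⁺ˡ (x ∷ []) (⊆ₚ.⊆-trans (interleaving-⊆ʳ sp) (⊆ₚ.xs⊆ys++xs ws₁ B))
        ; load-B   = load-B
        ; load-Bm  = λ f∈X′ → contradiction f∈X′ (Allₚ.All¬⇒¬Any X′-not-f) }
        where
        R≡ : o ∷ os ≡ (B ++ ws₁) ++ x ∷ ws₂ ++ v
        R≡ = begin
          o ∷ os                      ≡⟨ input ⟩
          B ++ ws ++ v                ≡⟨ cong (λ zs → B ++ zs ++ v) ws≡ ⟩
          B ++ (ws₁ ++ x ∷ ws₂) ++ v  ≡⟨ cong (B ++_) (++-assoc ws₁ (x ∷ ws₂) v) ⟩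
          B ++ ws₁ ++ x ∷ ws₂ ++ v    ≡⟨ ++-assoc B ws₁ _ ⟨
          (B ++ ws₁) ++ x ∷ ws₂ ++ v  ∎
          where open ≡-Reasoning
        X′-not-f : All (λ y → fam y ≢ f) (xs′ ∷ʳ x)
        X′-not-f = Allₚ.++⁻ˡ (xs′ ∷ʳ x)
                     (subst (All _) (trans u≡ (sym (++-assoc xs′ (x ∷ []) u₂))) u-family)
        load-B : load B + load (xs′ ∷ʳ x) ≤ load ((B ++ ws₁) ∷ʳ x)
        load-B rewrite load-∷ʳ xs′ x | load-∷ʳ (B ++ ws₁) x | load-++ B ws₁ | load-interleaving sp =
          ≤-by-slack (load m₁) (load-nonNeg m₁) (rearrange (load B) (load m₁) (load xs′) (p x))
          where
          rearrange : ∀ b a c q → b + (a + c) + q ≡ b + (c + q) + a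
          rearrange = solve-∀ ℚ-ring
      rest-position {xs′} {x} uv≡ | inj₂ (v₁ , v₂ , v≡ , refl) =
        B ++ ws ++ v₁ , v₂ , R≡ , record
          { families = ⊆ₚ.++⁺ˡ (x ∷ []) (⊆ₚ.⊆-trans (⊆ₚ.++⁺ˡ v₁ (interleaving-⊆ʳ merge))
                                                    (⊆ₚ.xs⊆ys++xs (ws ++ v₁) B))
          ; load-B   = ℚ.≤-trans (≤-by-slack (load m) (load-nonNeg m) (swap-m (load B) (load m) _))
                                 load-Bm
          ; load-Bm  = λ _ → load-Bm }
        where
        swap-m : ∀ a b c → a + b + c ≡ a + c + b
        swap-m = solve-∀ ℚ-ring
        R≡ : o ∷ os ≡ (B ++ ws ++ v₁) ++ x ∷ v₂
        R≡ = begin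
          o ∷ os                     ≡⟨ input ⟩
          B ++ ws ++ v               ≡⟨ cong (λ zs → B ++ ws ++ zs) v≡ ⟩
          B ++ ws ++ v₁ ++ x ∷ v₂    ≡⟨ cong (B ++_) (++-assoc ws v₁ _) ⟨
          B ++ (ws ++ v₁) ++ x ∷ v₂  ≡⟨ ++-assoc B (ws ++ v₁) _ ⟨
          (B ++ ws ++ v₁) ++ x ∷ v₂  ∎
          where open ≡-Reasoning
        load-Bm : load B + load m + load ((u ++ v₁) ∷ʳ x) ≤ load ((B ++ ws ++ v₁) ∷ʳ x)
        load-Bm rewrite load-∷ʳ (u ++ v₁) x | load-∷ʳ (B ++ ws ++ v₁) x | load-++ B (ws ++ v₁)
                      | load-++ ws v₁ | load-++ u v₁ | load-interleaving merge =
          ℚ.≤-reflexive (rearrange (load B) (load m) (load u) (load v₁) (p x))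
          where
          rearrange : ∀ b a c d q → b + a + (c + d + q) ≡ b + (a + c + d) + q
          rearrange = solve-∀ ℚ-ring

      rest-within : ∀ {t₀ t₁ x t} → t₁ ≤ t₀ + s f + (load B + load m) →
                    WithinBound t₁ renewed (u ++ v) x t → WithinBound t₀ c (o ∷ os) x t
      rest-within {t₀} {_} {x} {t} t₁≤ (xs′ , ys′ , uv≡ , t≤) with rest-position uv≡
      ... | xs , ys , R≡ , embedding = xs , ys , R≡ , bound
        where
        open PrefixEmbedding embedding
        X′ = xs′ ∷ʳ x
        X  = xs ∷ʳ x
        exchange : familySum renewed X′ + c f ≤ familySum c X + when (hasFamily? f X′) (renewed f)
        exchange = familySum-exchange c≥0 (λ g g≢f → updateAt-minimal g f c g≢f) families
                     (∈⇒HasFamily (head-∈-prefix R≡))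
        small : load m ≡ 0ℚ ⊎ load B + load m ≤ ρ * s f
        small = Sum.map₁ (cong load) fits
        bound : t ≤ t₀ + familySum c X + (1ℚ + ρ) * load X
        bound with hasFamily? f X′ | exchange
        ... | yes f∈X′ | exch = rest-combine {t₀ = t₀} {L₁ = load B + load m} t≤ t₁≤
                (ℚ.≤-trans exch (ℚ.≤-reflexive (cong (familySum c X +_) (updateAt-updates f c))))
                (batch-covered-renewed {c = c f} {LB = load B} head-credit po≤LB (load-nonNeg m))
                (load-Bm f∈X′)
        ... | no  _    | exch = rest-combine {t₀ = t₀} {L₁ = load B} t≤ t₁≤ exch
                (batch-covered {c = c f} {LB = load B} head-credit (s≥0 f) (p≥0 o) po≤LB small)
                load-B

      round-within : ∀ {prev t₀ x t} →
                     (x , t) ∈ origTimes I prev t₀ (transformOps I (suc n) ρ (o ∷ os)) →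
                     (∀ {prev t₀ x t} →
                        (x , t) ∈ origTimes I prev t₀ (transformOps I n ρ (u ++ v)) →
                        WithinBound t₀ renewed (u ++ v) x t) →
                     WithinBound t₀ c (o ∷ os) x t
      round-within {prev} {t₀} mem rest-bound
        with ∈-origTimes-++⁻ {prev} {t₀} (B ++ m)
               (subst (λ zs → _ ∈ origTimes I prev t₀ zs) (trans output (sym (++-assoc B m _))) mem)
      ... | inj₁ in-batch = batch-within {prev} {t₀} in-batch
      ... | inj₂ in-rest  =
        rest-within {t₀ = t₀} batch-end
          (rest-bound {lastFamily prev (B ++ m)} {endTime prev t₀ (B ++ m)} in-rest)
        where
        batch-end : endTime prev t₀ (B ++ m) ≤ t₀ + s f + (load B + load m)
        batch-end = begin
          endTime prev t₀ (B ++ m)                   ≤⟨ endTime-run prev t₀ (B ++ m)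
                                                          (refl ∷ Allₚ.++⁺ B-family m-family) ⟩
          t₀ + setupBefore I prev f + load (B ++ m)  ≤⟨ ℚ.+-monoˡ-≤ _
                                                          (ℚ.+-monoʳ-≤ t₀ (setupBefore-≤ prev f)) ⟩
          t₀ + s f + load (B ++ m)                   ≡⟨ cong (t₀ + s f +_) (load-++ B m) ⟩
          t₀ + s f + (load B + load m)               ∎
          where open ℚ.≤-Reasoning

    transformOps-within : ∀ n R → length R ℕ.≤ n → ∀ {c} → Credit c R → ∀ {prev t₀ x t} →
                          (x , t) ∈ origTimes I prev t₀ (transformOps I n ρ R) →
                          WithinBound t₀ c R x t
    transformOps-within _       []       _         _      ()
    transformOps-within zero    (o ∷ os) ()
    transformOps-within (suc n) (o ∷ os) (s≤s len) credit mem =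
      round-within mem (transformOps-within n (u ++ v) (ℕ.≤-trans shrinks len) renewed-credit)
      where
      rd = round n o os
      open Round rd using (u; v)
      open AfterRound rd credit

  -- The relaxed schedule

  relaxEnd : ℚ → List (Item I) → ℚ
  relaxEnd t []       = t
  relaxEnd t (i ∷ is) = relaxEnd (t + itemTime I i) is

  relaxTimes-∈ : ∀ t pre x post → (x , relaxEnd t pre + p x) ∈ relaxTimes I t (pre ++ inj₂ x ∷ post)
  relaxTimes-∈ t []             x post = here refl
  relaxTimes-∈ t (inj₁ f ∷ pre) x post = relaxTimes-∈ (t + s f) pre x post
  relaxTimes-∈ t (inj₂ o ∷ pre) x post = there (relaxTimes-∈ (t + p o) pre x post)

  setupSum : List (Item I) → ℚ
  setupSum pre = sum (λ g → when (inj₁ g ∈? pre) (s g))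

  relaxEnd-≥ : ∀ t pre → t + setupSum pre + load (opsOf I pre) ≤ relaxEnd t pre
  relaxEnd-≥ t [] = ℚ.≤-reflexive (begin-equality
    t + setupSum [] + 0ℚ  ≡⟨ ℚ.+-identityʳ _ ⟩
    t + setupSum []       ≡⟨ cong (t +_) (sum-replicate-zero K) ⟩
    t + 0ℚ                ≡⟨ ℚ.+-identityʳ t ⟩
    t                     ∎)
    where open ℚ.≤-Reasoning
  relaxEnd-≥ t (inj₁ f ∷ pre) =
    ℚ.≤-trans (shift {L = load (opsOf I pre)} setup-step) (relaxEnd-≥ (t + s f) pre)
    where
    open ℚ.≤-Reasoning
    shift : ∀ {a b q L} → a ≤ b + q → t + a + L ≤ t + q + b + L
    shift {a} {b} {q} {L} a≤ =
      ≤-by-slack (b + q - a) (p≤q⇒0≤q-p a≤) (solve (List ℚ ∋ t ∷ a ∷ b ∷ q ∷ L ∷ []) ℚ-ring)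
    fewer-setups : ∀ g → g ≢ f → when (inj₁ g ∈? inj₁ f ∷ pre) (s g) ≤ when (inj₁ g ∈? pre) (s g)
    fewer-setups g g≢f = when-mono (inj₁ g ∈? inj₁ f ∷ pre) (inj₁ g ∈? pre)
      (λ { (here g≡f) → contradiction (Sumₚ.inj₁-injective g≡f) g≢f ; (there g∈) → g∈ }) (s≥0 g)
    setup-step : setupSum (inj₁ f ∷ pre) ≤ setupSum pre + s f
    setup-step = begin
      setupSum (inj₁ f ∷ pre)                      ≤⟨ ≤-by-slack _ (when-nonNeg f∈pre? (s≥0 f)) refl ⟩
      setupSum (inj₁ f ∷ pre) + when f∈pre? (s f)  ≤⟨ sum-mono-≤-except f fewer-setups ⟩
      setupSum pre + when f∈f∷pre? (s f)           ≤⟨ ℚ.+-monoʳ-≤ (setupSum pre)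
                                                                  (when-≤ f∈f∷pre? (s≥0 f)) ⟩
      setupSum pre + s f                           ∎
      where
      f∈pre?   = inj₁ f ∈? pre
      f∈f∷pre? = inj₁ f ∈? inj₁ f ∷ pre
  relaxEnd-≥ t (inj₂ o ∷ pre) =
    ℚ.≤-trans (shift {L = load (opsOf I pre)} setup-step) (relaxEnd-≥ (t + p o) pre)
    where
    shift : ∀ {a b q L} → a ≤ b → t + a + (q + L) ≤ t + q + b + L
    shift {a} {b} {q} {L} a≤ =
      ≤-by-slack (b - a) (p≤q⇒0≤q-p a≤) (solve (List ℚ ∋ t ∷ a ∷ b ∷ q ∷ L ∷ []) ℚ-ring)
    setup-step : setupSum (inj₂ o ∷ pre) ≤ setupSum pre
    setup-step = sum-mono-≤ {a = λ g → when (inj₁ g ∈? inj₂ o ∷ pre) (s g)} λ g →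
      when-mono (inj₁ g ∈? inj₂ o ∷ pre) (inj₁ g ∈? pre) (λ { (here ()) ; (there g∈) → g∈ }) (s≥0 g)

  opsOf-split : ∀ σ {xs x ys} → opsOf I σ ≡ xs ++ x ∷ ys →
                ∃₂ λ pre post → σ ≡ pre ++ inj₂ x ∷ post × opsOf I pre ≡ xs
  opsOf-split [] {xs = []}    ()
  opsOf-split [] {xs = _ ∷ _} ()
  opsOf-split (inj₁ f ∷ σ) eq with opsOf-split σ eq
  ... | pre , post , refl , ops≡ = inj₁ f ∷ pre , post , refl , ops≡
  opsOf-split (inj₂ o ∷ σ) {[]}     refl = [] , σ , refl , refl
  opsOf-split (inj₂ o ∷ σ) {_ ∷ xs} eq with opsOf-split σ {xs} (∷-injectiveʳ eq) | ∷-injectiveˡ eq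
  ... | pre , post , refl , ops≡ | refl = inj₂ o ∷ pre , post , refl , cong (o ∷_) ops≡

  setup-present : ∀ {π} → IsRelaxSchedule I π → ∀ {pre x post} → π ≡ pre ++ inj₂ x ∷ post →
                  ∀ g → HasFamily g (opsOf I pre ∷ʳ x) → inj₁ g ∈ pre
  setup-present sched {pre} {x} {post} π≡ g g∈ with Anyₚ.++⁻ (opsOf I pre) g∈
  ... | inj₂ (here refl) = IsRelaxSchedule.setupsFirst sched pre x post π≡
  ... | inj₁ g∈pre with find g∈pre
  ...   | y , y∈ , refl with ∈-∃++ y∈
  ...     | _ , _ , ops≡ with opsOf-split pre ops≡
  ...       | a , b , refl , _ =
    ∈-++⁺ˡ (IsRelaxSchedule.setupsFirst sched a y (b ++ inj₂ x ∷ post) (trans π≡ (++-assoc a _ _)))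

  -- Weighted completion times

  timesOfJob-∈⁺ : ∀ {j x t} xs → (x , t) ∈ xs → job x ≡ j → t ∈ timesOfJob I j xs
  timesOfJob-∈⁺ {j} ((o , _) ∷ xs) x∈ jx≡j with job o ≟ᶠ j | x∈
  ... | yes _    | here refl = here refl
  ... | yes _    | there x∈′ = there (timesOfJob-∈⁺ xs x∈′ jx≡j)
  ... | no  jo≢j | here refl = contradiction jx≡j jo≢j
  ... | no  _    | there x∈′ = timesOfJob-∈⁺ xs x∈′ jx≡j

  timesOfJob-∈⁻ : ∀ {j t} xs → t ∈ timesOfJob I j xs → ∃ λ x → (x , t) ∈ xs × job x ≡ j
  timesOfJob-∈⁻ {j} ((o , _) ∷ xs) t∈ with job o ≟ᶠ j | t∈
  ... | yes jo≡j | here refl = o , here refl , jo≡j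
  ... | yes _    | there t∈′ = Prod.map₂ (Prod.map₁ there) (timesOfJob-∈⁻ xs t∈′)
  ... | no  _    | t∈′       = Prod.map₂ (Prod.map₁ there) (timesOfJob-∈⁻ xs t∈′)

  weighted-sum-≤ : ∀ {k} (a b : Fin nJ → ℚ) js → (∀ j → a j ≤ k * b j) →
                   sumℚ (map (λ j → w j * a j) js) ≤ k * sumℚ (map (λ j → w j * b j) js)
  weighted-sum-≤ {k} a b []       _    = ℚ.≤-reflexive (sym (ℚ.*-zeroʳ k))
  weighted-sum-≤ {k} a b (j ∷ js) a≤kb = begin
    w j * a j + Σa             ≤⟨ ℚ.+-mono-≤ (*-monoʳ-≤ (w≥0 j) (a≤kb j))
                                             (weighted-sum-≤ {k} a b js a≤kb) ⟩
    w j * (k * b j) + k * Σb   ≡⟨ factor (w j) k (b j) Σb ⟩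
    k * (w j * b j + Σb)       ∎
    where
    open ℚ.≤-Reasoning
    Σa = sumℚ (map (λ j → w j * a j) js)
    Σb = sumℚ (map (λ j → w j * b j) js)
    factor : ∀ wj k bj S → wj * (k * bj) + k * S ≡ k * (wj * bj + S)
    factor = solve-∀ ℚ-ring

  weightedCost-≤-scaled : ∀ {k xs ys} → 0ℚ ≤ k →
                          (∀ {x t} → (x , t) ∈ xs → ∃ λ r → (x , r) ∈ ys × t ≤ k * r) →
                          weightedCost I xs ≤ k * weightedCost I ys
  weightedCost-≤-scaled {k} {xs} {ys} 0≤k dominated = weighted-sum-≤ {k} _ _ (allFin nJ) job-≤
    where
    job-≤ : ∀ j → maxℚ (timesOfJob I j xs) ≤ k * maxℚ (timesOfJob I j ys)
    job-≤ j = maxℚ-lub (timesOfJob I j xs) (0≤* 0≤k (maxℚ-nonNeg (timesOfJob I j ys))) λ t∈ →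
      let x , x∈ , jx≡j = timesOfJob-∈⁻ xs t∈
          r , r∈ , t≤kr = dominated x∈
      in  ℚ.≤-trans t≤kr (*-monoʳ-≤ 0≤k (≤-maxℚ (timesOfJob-∈⁺ ys r∈ jx≡j)))

  module Comparison (ρ : ℚ) (0≤ρ : 0ℚ ≤ ρ) (2≤ρ² : 1ℚ + 1ℚ ≤ ρ * ρ) where
    open CreditArithmetic ρ 0≤ρ 2≤ρ²
    open Credits ρ 0≤ρ 2≤ρ²

    initial-credit : ∀ R → Credit (λ g → (1ℚ + ρ) * s g) R
    initial-credit R = record
      { c≥0    = λ g → 0≤* 0≤1+ρ (s≥0 g)
      ; covers = λ g → AtFirst-universal (λ o → ≤-by-slack _ (0≤ρ*½ (p≥0 o)) refl) R }

    completion-bound : ∀ {π} → IsRelaxSchedule I π → ∀ {x t} →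
                       (x , t) ∈ origTimes I nothing 0ℚ (transform I ρ π) →
                       ∃ λ r → (x , r) ∈ relaxTimes I 0ℚ π × t ≤ (1ℚ + ρ) * r
    completion-bound {π} sched {x} {t} mem
      with transformOps-within _ (opsOf I π) ℕ.≤-refl (initial-credit (opsOf I π)) mem
    ... | xs , ys , ops≡ , t≤ with opsOf-split π ops≡
    ... | pre , post , π≡ , refl =
      relaxEnd 0ℚ pre + p x ,
      subst (λ σ → _ ∈ relaxTimes I 0ℚ σ) (sym π≡) (relaxTimes-∈ 0ℚ pre x post) ,
      relaxed-combine t≤′ setups≤ (relaxEnd-≥ 0ℚ pre)
      where
      X = opsOf I pre ∷ʳ x
      t≤′ : t ≤ 0ℚ + (1ℚ + ρ) * familySum s X + (1ℚ + ρ) * (load (opsOf I pre) + p x)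
      t≤′ = subst₂ (λ F L → t ≤ 0ℚ + F + (1ℚ + ρ) * L)
                   (familySum-* (1ℚ + ρ) s X) (load-∷ʳ (opsOf I pre) x) t≤
      setups≤ : familySum s X ≤ setupSum pre
      setups≤ = sum-mono-≤ λ g →
        when-mono (hasFamily? g X) (inj₁ g ∈? pre) (setup-present sched π≡ g) (s≥0 g)

theorem1 : (I : Instance) → NonNegInstance I →
    (π : List-Item I) → IsRelaxSchedule I π →
    (ρ c opt : ℚ) → 0ℚ ≤ ρ → (1ℚ + 1ℚ) ≤ ρ * ρ →
    IsOPT I opt →
    relaxCost I π ≤ c * opt →
    origCost I (transform I ρ π) ≤ (1ℚ + ρ) * c * opt
theorem1 I nonNeg π sched ρ c opt 0≤ρ 2≤ρ² _ relax≤c*opt = begin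
  origCost I (transform I ρ π)  ≤⟨ weightedCost-≤-scaled 0≤1+ρ (completion-bound sched) ⟩
  (1ℚ + ρ) * relaxCost I π      ≤⟨ *-monoʳ-≤ 0≤1+ρ relax≤c*opt ⟩
  (1ℚ + ρ) * (c * opt)          ≡⟨ ℚ.*-assoc (1ℚ + ρ) c opt ⟨
  (1ℚ + ρ) * c * opt            ∎
  where
  open ℚ.≤-Reasoning
  open CreditArithmetic ρ 0≤ρ 2≤ρ²
  open Schedule I nonNeg
  open Comparison ρ 0≤ρ 2≤ρ²
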